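{- Let $R$ be a commutative ring, let $n,r\ge 1$ be integers, and let $A$ be an $n\times n$ matrix over $R$ with columns $A_1,\dots,A_n$. Let $p_{i,j}\in R$ be given for $1\le j\le r$ and $1\le i\le n+j-1$, and define column vectors \[A_{n+j}=\sum_{i=1}^{n+j-1}p_{i,j}A_i,\qquad j=1,2,\dots,r.\] Let $A_r=[A_1|A_2|\cdots|A_{n+r}]$ be the resulting $n\times(n+r)$ matrix. Let $P$ be the $(n+r-1)\times r$ matrix with entries \[P_{i,j}=\begin{cases}p_{i,j}, & i\le n+j-1,\\ -1, & i=n+j,\\ 0, & i>n+j.\end{cases}\] Let $1\le j_1<j_2<\cdots<j_r<n+r$ be integers. Let $M$ be the determinant of the $n\times n$ matrix obtained from $A_r$ by deleting the columns with indices $j_1,\dots,j_r$ (the remaining columns kept in their original order), and let $Q$ be the $r\times r$ submatrix of $P$ formed by the rows with indices $j_1,\dots,j_r$ (in this order). Then \[M=(-1)^{nr+j_1+j_2+\cdots+j_r+\frac{(r-1)r}{2}}\cdot\det Q\cdot\det A.\]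
   Context: The determinant $\det Q$ is called an $n$-determinant in the paper. -}

module Defs where

open import Level using (Level)
open import Algebra.Bundles using (CommutativeRing)
open import Data.Nat using (ℕ; zero; suc; _∸_; _<?_) renaming (_+_ to _+ℕ_)
open import Data.Fin using (Fin; zero; suc; toℕ; fromℕ<; punchIn)
open import Relation.Nullary using (yes; no)

snoc : ∀ {a} {X : Set a} {m : ℕ} → (Fin m → X) → X → Fin (suc m) → X
snoc {m = zero}  f x zero    = x
snoc {m = suc m} f x zero    = f zero
snoc {m = suc m} f x (suc i) = snoc (λ j → f (suc j)) x i

sumℕ : ∀ {m : ℕ} → (Fin m → ℕ) → ℕ
sumℕ {zero}  f = 0
sumℕ {suc m} f = f zero +ℕ sumℕ (λ i → f (suc i))

module _ {c ℓ : Level} (R : CommutativeRing c ℓ) where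
  open CommutativeRing R hiding (zero)

  Σ : ∀ {m : ℕ} → (Fin m → Carrier) → Carrier
  Σ {zero}  f = 0#
  Σ {suc m} f = f zero + Σ (λ i → f (suc i))

  signPow : ℕ → Carrier
  signPow zero    = 1#
  signPow (suc k) = - signPow k

  -- determinant of a square matrix (M i j = entry in row i, column j),
  -- defined by Laplace expansion along the first row
  det : ∀ {m : ℕ} → (Fin m → Fin m → Carrier) → Carrier
  det {zero}  M = 1#
  det {suc m} M =
    Σ (λ j → signPow (toℕ j) * (M zero j * det (λ i k → M (suc i) (punchIn j k))))

  -- Columns of the extended matrix A_r (0-indexed).
  -- A : n × n matrix, A row col.  p i j  (0-indexed) is the paper's p_{i+1,j+1};
  -- only the values with j < r and i < n + j are ever used.
  module Extended (n : ℕ) (A : Fin n → Fin n → Carrier) (p : ℕ → ℕ → Carrier) where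

    newcol : (m : ℕ) → (Fin m → Fin n → Carrier) → Fin n → Carrier
    newcol m g with m <? n
    ... | yes m<n = λ row → A row (fromℕ< m<n)
    ... | no  _   = λ row → Σ (λ (i : Fin m) → p (toℕ i) (m ∸ n) * g i row)

    prefix : (m : ℕ) → Fin m → Fin n → Carrier
    prefix zero    = λ ()
    prefix (suc m) = snoc (prefix m) (newcol m (prefix m))

    Ar : (r : ℕ) → Fin n → Fin (n +ℕ r) → Carrier
    Ar r row k = prefix (n +ℕ r) k row

  Pmat : (n : ℕ) (p : ℕ → ℕ → Carrier) → ℕ → ℕ → Carrier
  Pmat n p i j with i <? n +ℕ j | i <? suc (n +ℕ j)
  ... | yes _ | _     = p i j
  ... | no _  | yes _ = - 1#
  ... | no _  | no _  = 0#

module Submission where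

-- A choice of n kept and d deleted columns among the first n + d is
-- encoded as a Split, built column by column from the left.  For every split we prove
--   det (kept columns) = ± det Q · det A        (`claim`, exponent as in the theorem)
-- by induction on d.  With no deleted column the minor is A.  If the last column is
-- deleted, Q gains the row (0, …, 0, -1) and the sign flips.  If the last column is kept,
-- it is expanded by linearity into the earlier columns: kept ones give a repeated column,
-- and each deleted column b gives the minor of the split keeping b (induction); collecting
-- these terms is the expansion of det Q along its last column.

open import Defs
open import Level using (Level)
open import Algebra.Bundles using (CommutativeRing)
open import Data.Nat using (ℕ; zero; suc; _∸_; _≤_; _<_; _<?_; ⌊_/2⌋; s≤s; s≤s⁻¹) renaming (_*_ to _*ℕ_; _+_ to _+ℕ_)
import Data.Nat.Properties as ℕ
open import Data.Fin using (Fin; toℕ; zero; suc; punchIn; pinch; fromℕ; inject₁; fromℕ<)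
open import Data.Fin.Properties using (toℕ-fromℕ; toℕ-inject₁; toℕ<n; toℕ-injective; toℕ-fromℕ<; fromℕ<-toℕ; fromℕ<-cong)
open import Data.Vec.Functional using (insertAt)
open import Data.Vec.Functional.Properties using (insertAt-lookup; insertAt-punchIn; insertAt-removeAt)
open import Data.Product using (∃; Σ-syntax; _,_; _×_)
open import Data.Sum using (_⊎_; inj₁; inj₂)
import Data.Sum
open import Data.Empty using (⊥-elim)
open import Function using (_∘_)
open import Relation.Binary.PropositionalEquality as ≡ using (_≡_; _≢_; _≗_; cong; cong₂)
open import Relation.Nullary using (yes; no)
import Relation.Binary.Reasoning.Setoid as ≈-Reasoning

module Vectors where
  open ≡ using (refl)

  insertAt-punchIn-punchIn : ∀ {a} {X : Set a} {m} (f : Fin (suc m) → X) (t : Fin (suc (suc m))) x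
    (k : Fin (suc m)) (b : Fin (suc m)) →
    insertAt f t x (punchIn (punchIn t k) b) ≡ insertAt (f ∘ punchIn k) (pinch k t) x b
  insertAt-punchIn-punchIn f zero    x k       zero    = refl
  insertAt-punchIn-punchIn f zero    x k       (suc b) = refl
  insertAt-punchIn-punchIn f (suc t) x zero    b       = refl
  insertAt-punchIn-punchIn {m = suc m} f (suc t) x (suc k) zero    = refl
  insertAt-punchIn-punchIn {m = suc m} f (suc t) x (suc k) (suc b) =
    insertAt-punchIn-punchIn (f ∘ suc) t x k b

  punchIn-pinch : ∀ {m} (t : Fin (suc m)) (k : Fin m) → punchIn (punchIn t k) (pinch k t) ≡ t
  punchIn-pinch {suc m} zero    k       = refl
  punchIn-pinch {suc m} (suc t) zero    = refl
  punchIn-pinch {suc m} (suc t) (suc k) = cong suc (punchIn-pinch t k)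

  insertAt-map : ∀ {a b} {X : Set a} {Y : Set b} {m} (g : X → Y) (f : Fin m → X) (t : Fin (suc m)) x →
    ∀ i → g (insertAt f t x i) ≡ insertAt (g ∘ f) t (g x) i
  insertAt-map g f zero    x zero    = refl
  insertAt-map g f zero    x (suc i) = refl
  insertAt-map {m = suc m} g f (suc t) x zero    = refl
  insertAt-map {m = suc m} g f (suc t) x (suc i) = insertAt-map g (f ∘ suc) t x i

  snoc-last : ∀ {a} {X : Set a} {m} (f : Fin m → X) x → snoc f x (fromℕ m) ≡ x
  snoc-last {m = zero}  f x = refl
  snoc-last {m = suc m} f x = snoc-last (f ∘ suc) x

  snoc-inject₁ : ∀ {a} {X : Set a} {m} (f : Fin m → X) x i → snoc f x (inject₁ i) ≡ f i
  snoc-inject₁ {m = suc m} f x zero    = refl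
  snoc-inject₁ {m = suc m} f x (suc i) = snoc-inject₁ (f ∘ suc) x i

  snoc-cong : ∀ {a} {X : Set a} {m} {f g : Fin m → X} {x y} → f ≗ g → x ≡ y → snoc f x ≗ snoc g y
  snoc-cong {m = zero}  f≗g refl zero    = refl
  snoc-cong {m = suc m} f≗g x≡y  zero    = f≗g zero
  snoc-cong {m = suc m} f≗g x≡y  (suc i) = snoc-cong (f≗g ∘ suc) x≡y i

  snoc-map : ∀ {a b} {X : Set a} {Y : Set b} {m} (g : X → Y) (f : Fin m → X) x → ∀ i → g (snoc f x i) ≡ snoc (g ∘ f) (g x) i
  snoc-map {m = zero}  g f x zero    = refl
  snoc-map {m = suc m} g f x zero    = refl
  snoc-map {m = suc m} g f x (suc i) = snoc-map g (f ∘ suc) x i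

  insertAt-last : ∀ {a} {X : Set a} {m} (f : Fin m → X) x → insertAt f (fromℕ m) x ≗ snoc f x
  insertAt-last {m = zero}  f x zero    = refl
  insertAt-last {m = suc m} f x zero    = refl
  insertAt-last {m = suc m} f x (suc i) = insertAt-last (f ∘ suc) x i

  snoc-insertAt : ∀ {a} {X : Set a} {m} (f : Fin m → X) (t : Fin (suc m)) x y →
    snoc (insertAt f t x) y ≗ insertAt (snoc f y) (inject₁ t) x
  snoc-insertAt f zero    x y zero    = refl
  snoc-insertAt f zero    x y (suc i) = refl
  snoc-insertAt {m = suc m} f (suc t) x y zero    = refl
  snoc-insertAt {m = suc m} f (suc t) x y (suc i) = snoc-insertAt (f ∘ suc) t x y i

  data LastView : ∀ {m} → Fin (suc m) → Set where
    last  : ∀ {m} → LastView (fromℕ m)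
    inner : ∀ {m} (i : Fin (suc m)) → LastView (inject₁ i)

  lastView : ∀ {m} (i : Fin (suc m)) → LastView i
  lastView {zero}  zero = last
  lastView {suc m} zero = inner zero
  lastView {suc m} (suc i) with lastView i
  ... | last    = last
  ... | inner j = inner (suc j)

  punchIn-last : ∀ {m} (b : Fin m) → punchIn (fromℕ m) b ≡ inject₁ b
  punchIn-last {suc m} zero    = refl
  punchIn-last {suc m} (suc b) = cong suc (punchIn-last b)

  punchIn-inject₁-last : ∀ {m} (s : Fin (suc m)) → punchIn (inject₁ s) (fromℕ m) ≡ fromℕ (suc m)
  punchIn-inject₁-last zero          = refl
  punchIn-inject₁-last {suc m} (suc s) = cong suc (punchIn-inject₁-last s)

  punchIn-inject₁-inject₁ : ∀ {m} (s : Fin (suc m)) (b : Fin m) → punchIn (inject₁ s) (inject₁ b) ≡ inject₁ (punchIn s b)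
  punchIn-inject₁-inject₁ zero          b       = refl
  punchIn-inject₁-inject₁ {suc m} (suc s) zero    = refl
  punchIn-inject₁-inject₁ {suc m} (suc s) (suc b) = cong suc (punchIn-inject₁-inject₁ s b)

open Vectors

module Splits where
  open ≡ using (refl; sym; trans; subst; subst₂)

  -- A split of the columns 0, …, k+d-1 into k kept and d deleted columns, built from
  -- the left; keptCols and deletedCols enumerate both parts in increasing order.
  data Split : ℕ → ℕ → Set where
    []     : Split 0 0
    keep   : ∀ {k d} → Split k d → Split (suc k) d
    delete : ∀ {k d} → Split k d → Split k (suc d)

  keptCols : ∀ {k d} → Split k d → Fin k → ℕ
  keptCols (keep {k} {d} s) = snoc (keptCols s) (k +ℕ d)
  keptCols (delete s)       = keptCols s

  deletedCols : ∀ {k d} → Split k d → Fin d → ℕ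
  deletedCols (keep s)         = deletedCols s
  deletedCols (delete {k} {d} s) = snoc (deletedCols s) (k +ℕ d)

  deletedCols< : ∀ {k d} (s : Split k d) b → deletedCols s b < k +ℕ d
  deletedCols< (keep s) b = ℕ.m<n⇒m<1+n (deletedCols< s b)
  deletedCols< (delete {k} {d} s) b with lastView b
  ... | last    = subst (_< k +ℕ suc d) (sym (snoc-last (deletedCols s) (k +ℕ d))) (ℕ.+-monoʳ-< k ℕ.≤-refl)
  ... | inner c = subst (_< k +ℕ suc d) (sym (snoc-inject₁ (deletedCols s) (k +ℕ d) c))
                    (ℕ.<-trans (deletedCols< s c) (ℕ.+-monoʳ-< k ℕ.≤-refl))

  -- Keep the deleted column number b instead.
  restore : ∀ {k d} → Split k (suc d) → Fin (suc d) → Split (suc k) d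
  restore (keep s)   b = keep (restore s b)
  restore (delete s) b with lastView b
  ... | last    = keep s
  ... | inner c = delete (restore s c)

  deletedCols-restore : ∀ {k d} (s : Split k (suc d)) b → deletedCols (restore s b) ≗ deletedCols s ∘ punchIn b
  deletedCols-restore (keep s) b c = deletedCols-restore s b c
  deletedCols-restore (delete {k} s) b c with lastView b
  ... | last = sym (trans (cong (snoc (deletedCols s) _) (punchIn-last c)) (snoc-inject₁ (deletedCols s) _ c))
  deletedCols-restore (delete {k} {suc d} s) b c | inner b′ with lastView c
  ... | last     = trans (snoc-last (deletedCols (restore s b′)) _) (trans (sym (ℕ.+-suc k d)) (sym
                     (trans (cong (snoc (deletedCols s) _) (punchIn-inject₁-last b′)) (snoc-last (deletedCols s) _))))
  ... | inner c′ = trans (snoc-inject₁ (deletedCols (restore s b′)) _ c′) (trans (deletedCols-restore s b′ c′) (sym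
                     (trans (cong (snoc (deletedCols s) _) (punchIn-inject₁-inject₁ b′ c′)) (snoc-inject₁ (deletedCols s) _ _))))

  keptCols-restore : ∀ {k d} (s : Split k (suc d)) b → ∃ λ (t : Fin (suc k)) →
    (toℕ t +ℕ toℕ b ≡ deletedCols s b) × (keptCols (restore s b) ≗ insertAt (keptCols s) t (deletedCols s b))
  keptCols-restore (keep {k} {suc d} s) b with keptCols-restore s b
  ... | t , t+b≡ , kept≗ =
    inject₁ t , trans (cong (_+ℕ toℕ b) (toℕ-inject₁ t)) t+b≡ ,
    λ a → trans (snoc-cong kept≗ (sym (ℕ.+-suc k d)) a) (snoc-insertAt (keptCols s) t _ _ a)
  keptCols-restore (delete {k} {d} s) b with lastView b
  ... | last = fromℕ k ,
    trans (cong₂ _+ℕ_ (toℕ-fromℕ k) (toℕ-fromℕ d)) (sym (snoc-last (deletedCols s) _)) ,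
    λ a → trans (snoc-cong (λ _ → refl) (sym (snoc-last (deletedCols s) _)) a) (sym (insertAt-last (keptCols s) _ a))
  ... | inner c with keptCols-restore s c
  ...   | t , t+c≡ , kept≗ =
    t , trans (cong (toℕ t +ℕ_) (toℕ-inject₁ c)) (trans t+c≡ (sym (snoc-inject₁ (deletedCols s) _ c))) ,
    λ a → trans (kept≗ a) (cong (λ x → insertAt (keptCols s) t x a) (sym (snoc-inject₁ (deletedCols s) _ c)))

  keptCols-all : ∀ {k} (s : Split k 0) a → keptCols s a ≡ toℕ a
  keptCols-all (keep {k} s) a with lastView a
  ... | last    = trans (snoc-last (keptCols s) _) (trans (ℕ.+-identityʳ k) (sym (toℕ-fromℕ k)))
  ... | inner b = trans (snoc-inject₁ (keptCols s) _ b) (trans (keptCols-all s b) (sym (toℕ-inject₁ b)))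

  Increasing : ∀ {k} → (Fin k → ℕ) → Set
  Increasing K = ∀ a b → toℕ a < toℕ b → K a < K b

  record Complementary {k d} (N : ℕ) (K : Fin k → ℕ) (J : Fin d → ℕ) : Set where
    field
      K-increasing : Increasing K
      J-increasing : Increasing J
      K-bounded    : ∀ a → K a < N
      J-bounded    : ∀ b → J b < N
      disjoint     : ∀ a b → K a ≢ J b
      covering     : ∀ i → i < N → (∃ λ a → K a ≡ i) ⊎ (∃ λ b → J b ≡ i)

  open Complementary

  swap : ∀ {N k d} {K : Fin k → ℕ} {J : Fin d → ℕ} → Complementary N K J → Complementary N J K
  swap c = record
    { K-increasing = J-increasing c ; J-increasing = K-increasing c
    ; K-bounded = J-bounded c ; J-bounded = K-bounded c
    ; disjoint = λ b a e → disjoint c a b (sym e)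
    ; covering = λ i i<N → Data.Sum.swap (covering c i i<N) }

  increasing-inject₁ : ∀ {k} {K : Fin (suc k) → ℕ} → Increasing K → Increasing (K ∘ inject₁)
  increasing-inject₁ inc a b a<b = inc (inject₁ a) (inject₁ b) (subst₂ _<_ (sym (toℕ-inject₁ a)) (sym (toℕ-inject₁ b)) a<b)

  increasing-last : ∀ {k} {K : Fin (suc k) → ℕ} → Increasing K → ∀ a → K a ≤ K (fromℕ k)
  increasing-last {k} {K} inc a with lastView a
  ... | last    = ℕ.≤-refl
  ... | inner b = ℕ.<⇒≤ (inc (inject₁ b) (fromℕ k) (subst₂ _<_ (sym (toℕ-inject₁ b)) (sym (toℕ-fromℕ k)) (toℕ<n b)))

  snoc-inject₁-last : ∀ {k} (K : Fin (suc k) → ℕ) → snoc (K ∘ inject₁) (K (fromℕ k)) ≗ K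
  snoc-inject₁-last {k} K a with lastView a
  ... | last    = snoc-last (K ∘ inject₁) _
  ... | inner b = snoc-inject₁ (K ∘ inject₁) _ b

  removeLast : ∀ {N k d} {K : Fin (suc k) → ℕ} {J : Fin d → ℕ} → Complementary (suc N) K J →
    ∀ a → K a ≡ N → K (fromℕ k) ≡ N × Complementary N (K ∘ inject₁) J
  removeLast {N} {k} {K = K} {J} c a Ka≡N = last≡N , record
    { K-increasing = increasing-inject₁ (K-increasing c)
    ; J-increasing = J-increasing c
    ; K-bounded    = λ i → subst (K (inject₁ i) <_) last≡N
        (K-increasing c (inject₁ i) (fromℕ k) (subst₂ _<_ (sym (toℕ-inject₁ i)) (sym (toℕ-fromℕ k)) (toℕ<n i)))
    ; J-bounded    = λ b → ℕ.≤∧≢⇒< (s≤s⁻¹ (J-bounded c b)) (λ Jb≡N → disjoint c (fromℕ k) b (trans last≡N (sym Jb≡N)))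
    ; disjoint     = λ i → disjoint c (inject₁ i)
    ; covering     = covering′ }
    where
    last≡N : K (fromℕ k) ≡ N
    last≡N = ℕ.≤-antisym (s≤s⁻¹ (K-bounded c (fromℕ k))) (subst (_≤ K (fromℕ k)) Ka≡N (increasing-last (K-increasing c) a))
    covering′ : ∀ i → i < N → (∃ λ a → K (inject₁ a) ≡ i) ⊎ (∃ λ b → J b ≡ i)
    covering′ i i<N with covering c i (ℕ.m<n⇒m<1+n i<N)
    ... | inj₂ found = inj₂ found
    ... | inj₁ (a′ , Ka′≡i) with lastView a′
    ...   | last    = ⊥-elim (ℕ.<-irrefl (trans (sym Ka′≡i) last≡N) i<N)
    ...   | inner b = inj₁ (b , Ka′≡i)

  SplitOf : ∀ {k d} → ℕ → (Fin k → ℕ) → (Fin d → ℕ) → Set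
  SplitOf {k} {d} N K J = Σ[ s ∈ Split k d ] (k +ℕ d ≡ N × keptCols s ≗ K × deletedCols s ≗ J)

  mutual
    splitOf : ∀ N {k d} {K : Fin k → ℕ} {J : Fin d → ℕ} → Complementary N K J → SplitOf N K J
    splitOf zero {zero}  {zero}  c = [] , refl , (λ ()) , (λ ())
    splitOf zero {suc k}         c = ⊥-elim (ℕ.n≮0 (K-bounded c zero))
    splitOf zero {zero}  {suc d} c = ⊥-elim (ℕ.n≮0 (J-bounded c zero))
    splitOf (suc N) c with covering c N ℕ.≤-refl
    ... | inj₁ (a , Ka≡N) = keptLast c a Ka≡N
    ... | inj₂ (b , Jb≡N) = deletedLast c b Jb≡N

    keptLast : ∀ {N k d} {K : Fin k → ℕ} {J : Fin d → ℕ} → Complementary (suc N) K J → ∀ a → K a ≡ N → SplitOf (suc N) K J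
    keptLast {N} {suc k} {K = K} c a Ka≡N with removeLast c a Ka≡N
    ... | last≡N , c′ with splitOf N c′
    ...   | s , k+d≡N , kept≗ , deleted≗ =
      keep s , cong suc k+d≡N , (λ i → trans (snoc-cong kept≗ (trans k+d≡N (sym last≡N)) i) (snoc-inject₁-last K i)) , deleted≗

    deletedLast : ∀ {N k d} {K : Fin k → ℕ} {J : Fin d → ℕ} → Complementary (suc N) K J → ∀ b → J b ≡ N → SplitOf (suc N) K J
    deletedLast {N} {k} {suc d} {J = J} c b Jb≡N with removeLast (swap c) b Jb≡N
    ... | last≡N , c′ with splitOf N (swap c′)
    ...   | s , k+d≡N , kept≗ , deleted≗ =
      delete s , trans (ℕ.+-suc k d) (cong suc k+d≡N) , kept≗ ,
      (λ i → trans (snoc-cong deleted≗ (trans k+d≡N (sym last≡N)) i) (snoc-inject₁-last J i))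

  complementary : ∀ {N k d} (K : Fin k → Fin N) (J : Fin d → Fin N) → Increasing (toℕ ∘ K) → Increasing (toℕ ∘ J) →
    (∀ a b → K a ≢ J b) → (∀ i → (∃ λ a → K a ≡ i) ⊎ (∃ λ b → J b ≡ i)) → Complementary N (toℕ ∘ K) (toℕ ∘ J)
  complementary {N} K J K-increasing J-increasing disjoint covering = record
    { K-increasing = K-increasing
    ; J-increasing = J-increasing
    ; K-bounded    = λ a → toℕ<n (K a)
    ; J-bounded    = λ b → toℕ<n (J b)
    ; disjoint     = λ a b e → disjoint a b (toℕ-injective e)
    ; covering     = λ i i<N → Data.Sum.map (enumerates K i<N) (enumerates J i<N) (covering (fromℕ< i<N)) }
    where
    enumerates : ∀ {m} (E : Fin m → Fin N) {i} (i<N : i < N) → (∃ λ a → E a ≡ fromℕ< i<N) → ∃ λ a → toℕ (E a) ≡ i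
    enumerates E i<N (a , Ea≡i) = a , trans (cong toℕ Ea≡i) (toℕ-fromℕ< i<N)

open Splits

module Exponents where
  open ≡ using (refl; sym; trans)
  open import Data.Nat.Solver using (module +-*-Solver)
  open +-*-Solver using (solve; _:+_; _:*_; _:=_; con)

  sumℕ-cong : ∀ {m} {f g : Fin m → ℕ} → f ≗ g → sumℕ f ≡ sumℕ g
  sumℕ-cong {zero}  f≗g = refl
  sumℕ-cong {suc m} f≗g = cong₂ _+ℕ_ (f≗g zero) (sumℕ-cong (f≗g ∘ suc))

  sumℕ-snoc : ∀ {m} (f : Fin m → ℕ) x → sumℕ (snoc f x) ≡ sumℕ f +ℕ x
  sumℕ-snoc {zero}  f x = ℕ.+-identityʳ x
  sumℕ-snoc {suc m} f x = trans (cong (f zero +ℕ_) (sumℕ-snoc (f ∘ suc) x)) (sym (ℕ.+-assoc (f zero) _ x))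

  sumℕ-punchIn : ∀ {m} (s : Fin (suc m)) (f : Fin (suc m) → ℕ) → sumℕ f ≡ f s +ℕ sumℕ (f ∘ punchIn s)
  sumℕ-punchIn zero f = refl
  sumℕ-punchIn {suc m} (suc s) f = trans (cong (f zero +ℕ_) (sumℕ-punchIn s (f ∘ suc)))
    (solve 3 (λ a b c → a :+ (b :+ c) := b :+ (a :+ c)) refl (f zero) (f (suc s)) _)

  triangle : ℕ → ℕ
  triangle zero    = 0
  triangle (suc d) = d +ℕ triangle d

  triangle-twice : ∀ r → triangle r +ℕ triangle r +ℕ r ≡ r *ℕ r
  triangle-twice zero    = refl
  triangle-twice (suc r) = begin
    (r +ℕ t) +ℕ (r +ℕ t) +ℕ suc r  ≡⟨ solve 2 (λ r t → (r :+ t) :+ (r :+ t) :+ (con 1 :+ r) := con 1 :+ r :+ r :+ (t :+ t :+ r)) refl r t ⟩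
    suc (r +ℕ r +ℕ (t +ℕ t +ℕ r))  ≡⟨ cong (λ x → suc (r +ℕ r +ℕ x)) (triangle-twice r) ⟩
    suc (r +ℕ r +ℕ r *ℕ r)         ≡⟨ solve 1 (λ r → con 1 :+ r :+ r :+ r :* r := (con 1 :+ r) :* (con 1 :+ r)) refl r ⟩
    suc r *ℕ suc r                 ∎
    where
    open ≡.≡-Reasoning
    t = triangle r

  triangle-half : ∀ r → ⌊ (r ∸ 1) *ℕ r /2⌋ ≡ triangle r
  triangle-half zero    = refl
  triangle-half (suc r) = sym (trans (ℕ.n≡⌊n+n/2⌋ (triangle (suc r))) (cong ⌊_/2⌋ twice))
    where
    twice : triangle (suc r) +ℕ triangle (suc r) ≡ r *ℕ suc r
    twice = trans (solve 2 (λ r t → (r :+ t) :+ (r :+ t) := r :+ (t :+ t :+ r)) refl r (triangle r))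
              (trans (cong (r +ℕ_) (triangle-twice r)) (solve 1 (λ r → r :+ r :* r := r :* (con 1 :+ r)) refl r))

  -- Deleting one more column (the last one, number n + d) changes the exponent by an odd number.
  exponent-delete : ∀ n d S → n *ℕ suc d +ℕ (S +ℕ suc (n +ℕ d)) +ℕ triangle (suc d)
                              ≡ suc ((n +ℕ d) +ℕ (n +ℕ d) +ℕ (n *ℕ d +ℕ S +ℕ triangle d))
  exponent-delete n d S = solve 4 (λ n d s t → n :* (con 1 :+ d) :+ (s :+ (con 1 :+ (n :+ d))) :+ (d :+ t)
                              := con 1 :+ ((n :+ d) :+ (n :+ d) :+ (n :* d :+ s :+ t))) refl n d S (triangle d)

  -- Keeping the last column instead of deleted column b, sitting after t kept columns.
  exponent-keep : ∀ k d t b S → suc k *ℕ suc d +ℕ (suc (t +ℕ b) +ℕ S) +ℕ triangle (suc d) +ℕ d +ℕ b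
                                 ≡ suc (b +ℕ d) +ℕ suc (b +ℕ d) +ℕ (k +ℕ t +ℕ (suc k *ℕ d +ℕ S +ℕ triangle d))
  exponent-keep k d t b S = solve 6 (λ k d t b s x → (con 1 :+ k) :* (con 1 :+ d) :+ ((con 1 :+ (t :+ b)) :+ s) :+ (d :+ x) :+ d :+ b
                               := (con 1 :+ (b :+ d)) :+ (con 1 :+ (b :+ d)) :+ (k :+ t :+ ((con 1 :+ k) :* d :+ s :+ x))) refl k d t b S (triangle d)
open Exponents

module Determinants {c ℓ : Level} (R : CommutativeRing c ℓ) where
  open CommutativeRing R hiding (zero)
  open import Algebra.Properties.Ring ring using (-‿distribˡ-*; -‿distribʳ-*; -‿involutive)
  open import Algebra.Properties.Semiring.Sum semiring
    using (sum; sum-cong-≋; sum-remove; ∑-distrib-+; *-distribˡ-sum; *-distribʳ-sum; sum-init-last; sum-replicate-zero)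
    renaming (∑-comm to ∑-comm′)
  open import Algebra.Solver.Ring.NaturalCoefficients.Default commutativeSemiring using (solve; _:+_; _:*_; _:=_)
  open import Relation.Binary.Reasoning.Setoid setoid

  Matrix : ℕ → Set c
  Matrix m = Fin m → Fin m → Carrier

  sign : ℕ → Carrier
  sign = signPow R

  σ : ∀ {m} → Fin m → Carrier
  σ i = sign (toℕ i)

  sign-+ : ∀ a b → sign (a +ℕ b) ≈ sign a * sign b
  sign-+ zero    b = sym (*-identityˡ _)
  sign-+ (suc a) b = trans (-‿cong (sign-+ a b)) (-‿distribˡ-* _ _)

  sign-+-+ : ∀ a b e → sign (a +ℕ b +ℕ e) ≈ sign a * sign b * sign e
  sign-+-+ a b e = trans (sign-+ (a +ℕ b) e) (*-cong (sign-+ a b) refl)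

  sign-even : ∀ k a → sign (k +ℕ k +ℕ a) ≈ sign a
  sign-even zero    a = refl
  sign-even (suc k) a = begin
    sign (suc k +ℕ suc k +ℕ a)  ≡⟨ cong (λ e → sign (suc (e +ℕ a))) (ℕ.+-suc k k) ⟩
    - - sign (k +ℕ k +ℕ a)      ≈⟨ -‿involutive _ ⟩
    sign (k +ℕ k +ℕ a)          ≈⟨ sign-even k a ⟩
    sign a                      ∎

  sign-parity : ∀ a b k → a ≡ k +ℕ k +ℕ b → sign a ≈ sign b
  sign-parity a b k ≡.refl = sign-even k b

  sign-square : ∀ a → sign a * sign a ≈ 1#
  sign-square a = trans (sym (sign-+ a a)) (sign-parity (a +ℕ a) 0 a (≡.sym (ℕ.+-identityʳ (a +ℕ a))))

  neg*neg : ∀ x y → (- x) * (- y) ≈ x * y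
  neg*neg x y = trans (sym (-‿distribˡ-* x (- y))) (trans (-‿cong (sym (-‿distribʳ-* x y))) (-‿involutive _))

  neg*neg-* : ∀ x y z → (- x) * ((- y) * z) ≈ x * (y * z)
  neg*neg-* x y z = trans (*-cong refl (sym (-‿distribˡ-* y z))) (neg*neg x (y * z))

  -- The sign bookkeeping behind "delete column punchIn t k, then column t moves to pinch k t".
  σ-punchIn-pinch : ∀ {m} (t : Fin (suc (suc m))) (k : Fin (suc m)) → σ (punchIn t k) * σ (pinch k t) ≈ σ (suc k) * σ t
  σ-punchIn-pinch zero    k    = refl
  σ-punchIn-pinch (suc t) zero = trans (*-identityˡ _) (sym (trans (neg*neg 1# (σ t)) (*-identityˡ _)))
  σ-punchIn-pinch {suc m} (suc t) (suc k) = trans (neg*neg _ _) (trans (σ-punchIn-pinch t k) (sym (neg*neg _ _)))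

  -- Finite sums over Fin m.  They are kept opaque, so that a sum over Fin (suc m) is
  -- never unfolded while unifying; all that is used about them are the laws below.
  opaque
    ∑ : ∀ {m} → (Fin m → Carrier) → Carrier
    ∑ = sum

    Σ≈∑ : ∀ {m} (f : Fin m → Carrier) → Σ R f ≈ ∑ f
    Σ≈∑ {zero}  f = refl
    Σ≈∑ {suc m} f = +-cong refl (Σ≈∑ (f ∘ suc))

    ∑-empty : (f : Fin 0 → Carrier) → ∑ f ≈ 0#
    ∑-empty f = refl

    ∑-suc : ∀ {m} (f : Fin (suc m) → Carrier) → ∑ f ≈ f zero + ∑ (f ∘ suc)
    ∑-suc f = refl

    ∑-cong : ∀ {m} {f g : Fin m → Carrier} → (∀ i → f i ≈ g i) → ∑ f ≈ ∑ g
    ∑-cong = sum-cong-≋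

    ∑-zero : ∀ {m} (f : Fin m → Carrier) → (∀ i → f i ≈ 0#) → ∑ f ≈ 0#
    ∑-zero {m} f f≈0 = trans (sum-cong-≋ f≈0) (sum-replicate-zero m)

    ∑-remove : ∀ {m} (t : Fin (suc m)) (f : Fin (suc m) → Carrier) → ∑ f ≈ f t + ∑ (f ∘ punchIn t)
    ∑-remove t f = sum-remove f

    ∑-last : ∀ {m} (f : Fin (suc m) → Carrier) → ∑ f ≈ ∑ (f ∘ inject₁) + f (fromℕ m)
    ∑-last = sum-init-last

    ∑-+ : ∀ {m} (f g : Fin m → Carrier) → ∑ (λ i → f i + g i) ≈ ∑ f + ∑ g
    ∑-+ = ∑-distrib-+

    ∑-comm : ∀ {m k} (f : Fin m → Fin k → Carrier) → ∑ (λ i → ∑ (f i)) ≈ ∑ (λ j → ∑ (λ i → f i j))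
    ∑-comm = ∑-comm′

    ∑-*ˡ : ∀ {m} x (f : Fin m → Carrier) → x * ∑ f ≈ ∑ (λ i → x * f i)
    ∑-*ˡ = *-distribˡ-sum

    ∑-*ʳ : ∀ {m} x (f : Fin m → Carrier) → ∑ f * x ≈ ∑ (λ i → f i * x)
    ∑-*ʳ = *-distribʳ-sum

  minor : ∀ {m} → Matrix (suc m) → Fin (suc m) → Fin (suc m) → Matrix m
  minor M i j a b = M (punchIn i a) (punchIn j b)

  -- An opaque copy of `det`, for the same reason; all that is used about it is
  -- that it equals `det` and that it satisfies the first-row expansion.
  opaque
    unfolding ∑

    Det : ∀ {m} → Matrix m → Carrier
    Det = det R

    det≈Det : ∀ {m} (M : Matrix m) → det R M ≈ Det M
    det≈Det M = refl

    Det-empty : (M : Matrix 0) → Det M ≈ 1#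
    Det-empty M = refl

    det-row₀ : ∀ {m} (M : Matrix (suc m)) → Det M ≈ ∑ (λ j → σ j * (M zero j * Det (minor M zero j)))
    det-row₀ M = Σ≈∑ (λ j → σ j * (M zero j * Det (minor M zero j)))

  det-cong : ∀ {m} {M N : Matrix m} → (∀ i j → M i j ≈ N i j) → Det M ≈ Det N
  det-cong {zero}  {M} {N} M≈N = trans (Det-empty M) (sym (Det-empty N))
  det-cong {suc m} {M} {N} M≈N = trans (det-row₀ M) (trans
    (∑-cong (λ j → *-cong refl (*-cong (M≈N zero j) (det-cong (λ a b → M≈N (suc a) (punchIn j b))))))
    (sym (det-row₀ N)))

  det-zero-row : ∀ {m} (M : Matrix m) (i : Fin m) → (∀ j → M i j ≈ 0#) → Det M ≈ 0#
  det-zero-row {suc m} M zero    row≈0 = trans (det-row₀ M)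
    (∑-zero _ (λ j → trans (*-cong refl (trans (*-cong (row≈0 j) refl) (zeroˡ _))) (zeroʳ _)))
  det-zero-row {suc m} M (suc i) row≈0 = trans (det-row₀ M)
    (∑-zero _ (λ j → trans (*-cong refl (trans (*-cong refl (det-zero-row _ i (row≈0 ∘ punchIn j))) (zeroʳ _))) (zeroʳ _)))

  withColumn : ∀ {m k} → (Fin m → Fin k → Carrier) → Fin (suc k) → (Fin m → Carrier) → Fin m → Fin (suc k) → Carrier
  withColumn U t v i = insertAt (U i) t (v i)

  -- Deleting the first row and column k of U (the cofactor of U₀ₖ when v is in front).
  cofactorFront : ∀ {m} → (Fin (suc m) → Fin m → Carrier) → (Fin (suc m) → Carrier) → Fin m → Matrix m
  cofactorFront {suc m} U v k = withColumn (λ a → U (suc a) ∘ punchIn k) zero (v ∘ suc)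

  minor-withColumn : ∀ {m} (U : Fin (suc (suc m)) → Fin (suc m) → Carrier) t v (k : Fin (suc m)) →
    ∀ a b → minor (withColumn U t v) zero (punchIn t k) a b ≈ withColumn (λ a → U (suc a) ∘ punchIn k) (pinch k t) (v ∘ suc) a b
  minor-withColumn U t v k a b = reflexive (insertAt-punchIn-punchIn (U (suc a)) t (v (suc a)) k b)

  det-front : ∀ {m} (U : Fin (suc m) → Fin m → Carrier) (v : Fin (suc m) → Carrier) →
    Det (withColumn U zero v) ≈ v zero * Det (U ∘ suc) + ∑ (λ k → σ (suc k) * (U zero k * Det (cofactorFront U v k)))
  det-front {zero}  U v = trans (det-row₀ (withColumn U zero v)) (trans (∑-suc _) (+-cong (*-identityˡ _) (∑-cong (λ ()))))
  det-front {suc m} U v = trans (det-row₀ (withColumn U zero v)) (trans (∑-suc _) (+-cong (*-identityˡ _)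
    (∑-cong (λ k → *-cong refl (*-cong refl (det-cong (minor-withColumn U zero v k)))))))

  det-withColumn : ∀ {m} (U : Fin (suc m) → Fin m → Carrier) t v →
    Det (withColumn U t v) ≈ σ t * Det (withColumn U zero v)
  det-withColumn {zero}  U zero v = sym (*-identityˡ _)
  det-withColumn {suc m} U t    v = begin
    Det W
      ≈⟨ det-row₀ W ⟩
    ∑ (λ j → σ j * (W zero j * Det (minor W zero j)))
      ≈⟨ ∑-remove t _ ⟩
    σ t * (W zero t * Det (minor W zero t))
      + ∑ (λ k → σ (punchIn t k) * (W zero (punchIn t k) * Det (minor W zero (punchIn t k))))
      ≈⟨ +-cong (*-cong refl (*-cong (reflexive (insertAt-lookup (U zero) t (v zero)))
                                      (det-cong (λ a b → reflexive (insertAt-punchIn (U (suc a)) t (v (suc a)) b)))))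
                (∑-cong (λ k → *-cong refl (*-cong (reflexive (insertAt-punchIn (U zero) t (v zero) k))
                   (trans (det-cong (minor-withColumn U t v k)) (det-withColumn _ (pinch k t) _))))) ⟩
    σ t * (v zero * Det (U ∘ suc))
      + ∑ (λ k → σ (punchIn t k) * (U zero k * (σ (pinch k t) * Det (cofactorFront U v k))))
      ≈⟨ +-cong refl (trans (∑-cong (λ k → regroup (σ-punchIn-pinch t k))) (sym (∑-*ˡ _ _))) ⟩
    σ t * (v zero * Det (U ∘ suc)) + σ t * ∑ (λ k → σ (suc k) * (U zero k * Det (cofactorFront U v k)))
      ≈⟨ sym (trans (*-cong refl (det-front U v)) (distribˡ _ _ _)) ⟩
    σ t * Det (withColumn U zero v) ∎
    where
    W = withColumn U t v
    regroup : ∀ {a b c d u D} → a * b ≈ c * d → a * (u * (b * D)) ≈ d * (c * (u * D))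
    regroup {a} {b} {c} {d} {u} {D} ab≈cd = begin
      a * (u * (b * D)) ≈⟨ solve 4 (λ a b u D → a :* (u :* (b :* D)) := (a :* b) :* (u :* D)) refl a b u D ⟩
      (a * b) * (u * D) ≈⟨ *-cong ab≈cd refl ⟩
      (c * d) * (u * D) ≈⟨ solve 4 (λ c d u D → (c :* d) :* (u :* D) := d :* (c :* (u :* D))) refl c d u D ⟩
      d * (c * (u * D)) ∎

  withColumn-cong : ∀ {m k} (U : Fin m → Fin k → Carrier) {v w : Fin m → Carrier} → (∀ i → v i ≈ w i) →
    ∀ i j → withColumn U zero v i j ≈ withColumn U zero w i j
  withColumn-cong U v≈w i zero    = v≈w i
  withColumn-cong U v≈w i (suc j) = refl

  det-repeated : ∀ {m} (U : Fin (suc m) → Fin m → Carrier) (v : Fin (suc m) → Carrier) (s : Fin m) →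
    (∀ i → v i ≈ U i s) → Det (withColumn U zero v) ≈ 0#
  det-repeated {suc m} U v s v≈Us = begin
    Det (withColumn U zero v)
      ≈⟨ det-front U v ⟩
    v zero * Det (U ∘ suc) + ∑ (λ k → σ (suc k) * (U zero k * D k))
      ≈⟨ +-cong refl (∑-remove s _) ⟩
    v zero * Det (U ∘ suc) + (σ (suc s) * (U zero s * D s) + ∑ (λ k → σ (suc (punchIn s k)) * (U zero (punchIn s k) * D (punchIn s k))))
      ≈⟨ +-cong (*-cong (v≈Us zero) D₀≈) (+-cong refl (∑-zero _ (λ k → trans (*-cong refl (*-cong refl (other k))) (trans (*-cong refl (zeroʳ _)) (zeroʳ _))))) ⟩
    U zero s * (σ s * D s) + (- σ s * (U zero s * D s) + 0#)
      ≈⟨ +-cong (solve 3 (λ u x d → u :* (x :* d) := x :* (u :* d)) refl (U zero s) (σ s) (D s))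
                (trans (+-identityʳ _) (sym (-‿distribˡ-* _ _))) ⟩
    σ s * (U zero s * D s) - σ s * (U zero s * D s)
      ≈⟨ -‿inverseʳ _ ⟩
    0# ∎
    where
    D : Fin (suc m) → Carrier
    D k = Det (cofactorFront U v k)
    -- Deleting the first row, column s moves to the front.
    D₀≈ : Det (U ∘ suc) ≈ σ s * D s
    D₀≈ = begin
      Det (U ∘ suc)
        ≈⟨ det-cong (λ a b → reflexive (≡.sym (insertAt-removeAt (U (suc a)) s b))) ⟩
      Det (withColumn (λ a → U (suc a) ∘ punchIn s) s (λ a → U (suc a) s))
        ≈⟨ det-withColumn _ s _ ⟩
      σ s * Det (withColumn (λ a → U (suc a) ∘ punchIn s) zero (λ a → U (suc a) s))
        ≈⟨ *-cong refl (det-cong (withColumn-cong _ (λ a → sym (v≈Us (suc a))))) ⟩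
      σ s * D s ∎
    -- The other cofactors still contain the repeated column.
    other : ∀ k → D (punchIn s k) ≈ 0#
    other k = det-repeated _ (v ∘ suc) (pinch k s)
      (λ a → trans (v≈Us (suc a)) (reflexive (cong (U (suc a)) (≡.sym (punchIn-pinch s k)))))

  det-linear-step : ∀ {m L} (U : Fin (suc m) → Fin m → Carrier) (c : Fin L → Carrier) (w : Fin L → Fin (suc m) → Carrier) →
    (∀ k → Det (cofactorFront U (λ i → ∑ (λ l → c l * w l i)) k) ≈ ∑ (λ l → c l * Det (cofactorFront U (w l) k))) →
    Det (withColumn U zero (λ i → ∑ (λ l → c l * w l i))) ≈ ∑ (λ l → c l * Det (withColumn U zero (w l)))
  det-linear-step U c w cofactors = begin
    Det (withColumn U zero (λ i → ∑ (λ l → c l * w l i)))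
      ≈⟨ det-front U _ ⟩
    ∑ (λ l → c l * w l zero) * D₀ + ∑ (λ k → σ (suc k) * (U zero k * Det (cofactorFront U (λ i → ∑ (λ l → c l * w l i)) k)))
      ≈⟨ +-cong (trans (∑-*ʳ _ _) (∑-cong (λ l → *-assoc _ _ _)))
                (∑-cong (λ k → trans (*-cong refl (trans (*-cong refl (cofactors k)) (∑-*ˡ _ _))) (∑-*ˡ _ _))) ⟩
    ∑ (λ l → c l * (w l zero * D₀)) + ∑ (λ k → ∑ (λ l → σ (suc k) * (U zero k * (c l * F l k))))
      ≈⟨ +-cong refl (trans (∑-comm _) (∑-cong (λ l → trans (∑-cong (λ k → pull (c l))) (sym (∑-*ˡ _ _))))) ⟩
    ∑ (λ l → c l * (w l zero * D₀)) + ∑ (λ l → c l * ∑ (λ k → σ (suc k) * (U zero k * F l k)))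
      ≈⟨ sym (trans (∑-cong (λ l → trans (*-cong refl (det-front U (w l))) (distribˡ _ _ _))) (∑-+ _ _)) ⟩
    ∑ (λ l → c l * Det (withColumn U zero (w l))) ∎
    where
    D₀ = Det (U ∘ suc)
    F = λ l k → Det (cofactorFront U (w l) k)
    pull : ∀ {s u f} x → s * (u * (x * f)) ≈ x * (s * (u * f))
    pull {s} {u} {f} x = solve 4 (λ s u x f → s :* (u :* (x :* f)) := x :* (s :* (u :* f))) refl s u x f

  det-linear : ∀ {m L} (U : Fin (suc m) → Fin m → Carrier) (c : Fin L → Carrier) (w : Fin L → Fin (suc m) → Carrier) →
    Det (withColumn U zero (λ i → ∑ (λ l → c l * w l i))) ≈ ∑ (λ l → c l * Det (withColumn U zero (w l)))
  det-linear {zero}  U c w = det-linear-step U c w (λ ())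
  det-linear {suc m} U c w = det-linear-step U c w (λ k → det-linear (λ a → U (suc a) ∘ punchIn k) c (λ l → w l ∘ suc))

  det-column₀-step : ∀ {m} (U : Fin (suc (suc m)) → Fin (suc m) → Carrier) (v : Fin (suc (suc m)) → Carrier) →
    (∀ k → Det (cofactorFront U v k) ≈ ∑ (λ i → σ i * (v (suc i) * Det (λ a → U (suc (punchIn i a)) ∘ punchIn k)))) →
    Det (withColumn U zero v) ≈ ∑ (λ i → σ i * (v i * Det (U ∘ punchIn i)))
  det-column₀-step {m} U v cofactors = begin
    Det (withColumn U zero v)
      ≈⟨ det-front U v ⟩
    v zero * Det (U ∘ suc) + ∑ (λ k → σ (suc k) * (U zero k * Det (cofactorFront U v k)))
      ≈⟨ +-cong refl (∑-cong (λ k → trans (*-cong refl (trans (*-cong refl (cofactors k)) (∑-*ˡ _ _))) (∑-*ˡ _ _))) ⟩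
    v zero * Det (U ∘ suc) + ∑ (λ k → ∑ (λ i → σ (suc k) * (U zero k * (σ i * (v (suc i) * G i k)))))
      ≈⟨ +-cong refl (trans (∑-comm _) (∑-cong (λ i → trans (∑-cong (λ k → swap-signs i k))
                                                          (trans (sym (∑-*ˡ _ _)) (*-cong refl (sym (∑-*ˡ _ _))))))) ⟩
    v zero * Det (U ∘ suc) + ∑ (λ i → σ (suc i) * (v (suc i) * ∑ (λ k → σ k * (U zero k * G i k))))
      ≈⟨ +-cong (sym (*-identityˡ _)) (∑-cong (λ i → *-cong refl (*-cong refl (sym (det-row₀ (U ∘ punchIn (suc i))))))) ⟩
    σ (zero {n = m}) * (v zero * Det (U ∘ suc)) + ∑ (λ i → σ (suc i) * (v (suc i) * Det (U ∘ punchIn (suc i))))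
      ≈⟨ sym (∑-suc _) ⟩
    ∑ (λ i → σ i * (v i * Det (U ∘ punchIn i))) ∎
    where
    G = λ i k → Det (λ a → U (suc (punchIn i a)) ∘ punchIn k)
    swap-signs : ∀ i k → σ (suc k) * (U zero k * (σ i * (v (suc i) * G i k)))
                       ≈ σ (suc i) * (v (suc i) * (σ k * (U zero k * G i k)))
    swap-signs i k = trans (sym (-‿distribˡ-* _ _)) (trans (-‿cong (solve 5
      (λ a u b x g → a :* (u :* (b :* (x :* g))) := b :* (x :* (a :* (u :* g)))) refl
      (σ k) (U zero k) (σ i) (v (suc i)) (G i k))) (-‿distribˡ-* _ _))

  det-column₀ : ∀ {m} (U : Fin (suc m) → Fin m → Carrier) (v : Fin (suc m) → Carrier) →
    Det (withColumn U zero v) ≈ ∑ (λ i → σ i * (v i * Det (U ∘ punchIn i)))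
  det-column₀ {zero}  U v = begin
    Det (withColumn U zero v)
      ≈⟨ det-front U v ⟩
    v zero * Det (U ∘ suc) + ∑ (λ k → σ (suc k) * (U zero k * Det (cofactorFront U v k)))
      ≈⟨ +-cong (sym (*-identityˡ _)) (∑-cong (λ ())) ⟩
    σ (zero {n = 0}) * (v zero * Det (U ∘ suc)) + ∑ (λ i → σ (suc i) * (v (suc i) * Det (U ∘ punchIn (suc i))))
      ≈⟨ sym (∑-suc _) ⟩
    ∑ (λ i → σ i * (v i * Det (U ∘ punchIn i))) ∎
  det-column₀ {suc m} U v = det-column₀-step U v (λ k → det-column₀ (λ a → U (suc a) ∘ punchIn k) (v ∘ suc))

  det-column : ∀ {m} (t : Fin (suc m)) (M : Matrix (suc m)) →
    Det M ≈ σ t * ∑ (λ i → σ i * (M i t * Det (minor M i t)))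
  det-column t M = begin
    Det M
      ≈⟨ det-cong (λ i j → reflexive (≡.sym (insertAt-removeAt (M i) t j))) ⟩
    Det (withColumn (λ i → M i ∘ punchIn t) t (λ i → M i t))
      ≈⟨ det-withColumn _ t _ ⟩
    σ t * Det (withColumn (λ i → M i ∘ punchIn t) zero (λ i → M i t))
      ≈⟨ *-cong refl (det-column₀ _ _) ⟩
    σ t * ∑ (λ i → σ i * (M i t * Det (minor M i t))) ∎

  ∑< : ℕ → (ℕ → Carrier) → Carrier
  ∑< N f = ∑ (λ (i : Fin N) → f (toℕ i))

  ∑<-suc : ∀ N f → ∑< (suc N) f ≈ ∑< N f + f N
  ∑<-suc N f = trans (∑-last _) (+-cong (∑-cong (λ i → reflexive (cong f (toℕ-inject₁ i)))) (reflexive (cong f (toℕ-fromℕ N))))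

  ∑-snoc : ∀ {a} {X : Set a} {m} (f : X → Carrier) (g : Fin m → X) x → ∑ (f ∘ snoc g x) ≈ ∑ (f ∘ g) + f x
  ∑-snoc f g x = trans (∑-last _)
    (+-cong (∑-cong (λ i → reflexive (cong f (snoc-inject₁ g x i)))) (reflexive (cong f (snoc-last g x))))

  ∑<-split : ∀ {k d} (s : Split k d) f → ∑< (k +ℕ d) f ≈ ∑ (f ∘ keptCols s) + ∑ (f ∘ deletedCols s)
  ∑<-split [] f = trans (∑-empty _) (sym (trans (+-cong (∑-empty _) (∑-empty _)) (+-identityˡ _)))
  ∑<-split (keep {k} {d} s) f = begin
    ∑< (suc (k +ℕ d)) f                                          ≈⟨ ∑<-suc _ f ⟩
    ∑< (k +ℕ d) f + f (k +ℕ d)                                   ≈⟨ +-cong (∑<-split s f) refl ⟩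
    ∑ (f ∘ keptCols s) + ∑ (f ∘ deletedCols s) + f (k +ℕ d)      ≈⟨ solve 3 (λ x y z → x :+ y :+ z := x :+ z :+ y) refl _ _ _ ⟩
    ∑ (f ∘ keptCols s) + f (k +ℕ d) + ∑ (f ∘ deletedCols s)      ≈⟨ +-cong (sym (∑-snoc f (keptCols s) _)) refl ⟩
    ∑ (f ∘ keptCols (keep s)) + ∑ (f ∘ deletedCols (keep s))     ∎
  ∑<-split (delete {k} {d} s) f = begin
    ∑< (k +ℕ suc d) f                                            ≡⟨ cong (λ N → ∑< N f) (ℕ.+-suc k d) ⟩
    ∑< (suc (k +ℕ d)) f                                          ≈⟨ ∑<-suc _ f ⟩
    ∑< (k +ℕ d) f + f (k +ℕ d)                                   ≈⟨ +-cong (∑<-split s f) refl ⟩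
    ∑ (f ∘ keptCols s) + ∑ (f ∘ deletedCols s) + f (k +ℕ d)      ≈⟨ +-assoc _ _ _ ⟩
    ∑ (f ∘ keptCols s) + (∑ (f ∘ deletedCols s) + f (k +ℕ d))    ≈⟨ +-cong refl (sym (∑-snoc f (deletedCols s) _)) ⟩
    ∑ (f ∘ keptCols (delete s)) + ∑ (f ∘ deletedCols (delete s)) ∎

module Extension {c ℓ : Level} (R : CommutativeRing c ℓ) (p : ℕ → ℕ → CommutativeRing.Carrier R) where
  open CommutativeRing R hiding (zero)
  open Determinants R
  open import Algebra.Properties.Ring ring using (-1*x≈-x)
  open import Relation.Binary.Reasoning.Setoid setoid
  open import Algebra.Solver.Ring.NaturalCoefficients.Default commutativeSemiring using (solve; _:*_; _:=_)

  column : ∀ {n} → Matrix n → ℕ → Fin n → Carrier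
  column {n} A m = Extended.newcol R n A p m (Extended.prefix R n A p m)

  prefix-column : ∀ {n} (A : Matrix n) m (i : Fin m) row → Extended.prefix R n A p m i row ≡ column A (toℕ i) row
  prefix-column {n} A (suc m) i row with lastView i
  ... | last    = ≡.trans (cong (λ col → col row) (snoc-last (Extended.prefix R n A p m) _))
                          (cong (λ j → column A j row) (≡.sym (toℕ-fromℕ m)))
  ... | inner j = ≡.trans (cong (λ col → col row) (snoc-inject₁ (Extended.prefix R n A p m) _ j))
                          (≡.trans (prefix-column A m j row) (cong (λ j → column A j row) (≡.sym (toℕ-inject₁ j))))

  column-original : ∀ {n} (A : Matrix n) m (m<n : m < n) row → column A m row ≡ A row (fromℕ< m<n)
  column-original {n} A m m<n row with m <? n
  ... | yes m<n′ = cong (A row) (fromℕ<-cong m m ≡.refl m<n′ m<n)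
  ... | no  m≮n  = ⊥-elim (m≮n m<n)

  column-new : ∀ {n} (A : Matrix n) m → n ≤ m → ∀ row → column A m row ≈ ∑< m (λ i → p i (m ∸ n) * column A i row)
  column-new {n} A m n≤m row with m <? n
  ... | yes m<n = ⊥-elim (ℕ.<⇒≱ m<n n≤m)
  ... | no  _   = trans (Σ≈∑ _) (∑-cong (λ i → *-cong refl (reflexive (prefix-column A m i row))))

  Pmat-above : ∀ n i j → i < n +ℕ j → Pmat R n p i j ≡ p i j
  Pmat-above n i j i<n+j with i <? n +ℕ j | i <? suc (n +ℕ j)
  ... | yes _ | _ = ≡.refl
  ... | no  ¬i<n+j | _ = ⊥-elim (¬i<n+j i<n+j)

  Pmat-diagonal : ∀ n j → Pmat R n p (n +ℕ j) j ≡ - 1#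
  Pmat-diagonal n j with n +ℕ j <? n +ℕ j | n +ℕ j <? suc (n +ℕ j)
  ... | yes n+j<n+j | _     = ⊥-elim (ℕ.<-irrefl ≡.refl n+j<n+j)
  ... | no  _       | yes _ = ≡.refl
  ... | no  _       | no  ¬n+j<1+n+j = ⊥-elim (¬n+j<1+n+j ℕ.≤-refl)

  Pmat-below : ∀ n i j → n +ℕ j < i → Pmat R n p i j ≡ 0#
  Pmat-below n i j n+j<i with i <? n +ℕ j | i <? suc (n +ℕ j)
  ... | yes i<n+j | _       = ⊥-elim (ℕ.<-asym i<n+j n+j<i)
  ... | no  _     | yes i≤n+j = ⊥-elim (ℕ.<-irrefl ≡.refl (ℕ.<-≤-trans n+j<i (s≤s⁻¹ i≤n+j)))
  ... | no  _     | no  _   = ≡.refl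

  keptColumns : ∀ {n k d} → Matrix n → Split k d → Fin n → Fin k → Carrier
  keptColumns A s row a = column A (keptCols s a) row

  Qof : ∀ {n d} → Split n d → Matrix d
  Qof {n} s a b = Pmat R n p (deletedCols s a) (toℕ b)

  exponent : ∀ {n d} → Split n d → ℕ
  exponent {n} {d} s = n *ℕ d +ℕ sumℕ (λ b → suc (deletedCols s b)) +ℕ triangle d

  Claim : ∀ {n d} → Matrix n → Split n d → Set ℓ
  Claim A s = Det (keptColumns A s) ≈ sign (exponent s) * (Det (Qof s) * Det A)

  claim-all-kept : ∀ {n} (A : Matrix n) (s : Split n 0) → Claim A s
  claim-all-kept {n} A s = begin
    Det (keptColumns A s)    ≈⟨ det-cong (λ row a → reflexive (kept-original row a)) ⟩
    Det A                    ≈⟨ sym (trans (*-cong (reflexive (cong sign exponent≡0)) (*-cong (Det-empty _) refl))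
                                           (trans (*-identityˡ _) (*-identityˡ _))) ⟩
    sign (exponent s) * (Det (Qof s) * Det A) ∎
    where
    kept-original : ∀ row a → keptColumns A s row a ≡ A row a
    kept-original row a = ≡.trans (cong (λ j → column A j row) (keptCols-all s a))
      (≡.trans (column-original A (toℕ a) (toℕ<n a) row) (cong (A row) (fromℕ<-toℕ a (toℕ<n a))))
    exponent≡0 : exponent s ≡ 0
    exponent≡0 = cong (λ x → x +ℕ 0 +ℕ 0) (ℕ.*-zeroʳ n)

  -- Deleting the last column n + d appends to Q the row (0, …, 0, -1) ...
  Q-delete-lastRow : ∀ {n d} (s : Split n d) (b : Fin d) → Qof (delete s) (fromℕ d) (inject₁ b) ≈ 0#
  Q-delete-lastRow {n} {d} s b = reflexive (≡.trans (cong₂ (Pmat R n p) (snoc-last (deletedCols s) _) (toℕ-inject₁ b))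
    (Pmat-below n (n +ℕ d) (toℕ b) (ℕ.+-monoʳ-< n (toℕ<n b))))

  Q-delete-corner : ∀ {n d} (s : Split n d) → Qof (delete s) (fromℕ d) (fromℕ d) ≈ - 1#
  Q-delete-corner {n} {d} s = reflexive (≡.trans (cong₂ (Pmat R n p) (snoc-last (deletedCols s) _) (toℕ-fromℕ d))
    (Pmat-diagonal n d))

  -- ... so the minors of its last column through other rows vanish ...
  Q-delete-minor : ∀ {n d} (s : Split n d) (a : Fin d) → Det (minor (Qof (delete s)) (inject₁ a) (fromℕ d)) ≈ 0#
  Q-delete-minor {d = suc d} s a = det-zero-row _ (fromℕ d) (λ b →
    trans (reflexive (cong₂ (Qof (delete s)) (punchIn-inject₁-last a) (punchIn-last b))) (Q-delete-lastRow s b))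

  -- ... and expanding along the last column gives det Q′ = - det Q.
  Q-delete : ∀ {n d} (s : Split n d) → Det (Qof (delete s)) ≈ - Det (Qof s)
  Q-delete {n} {d} s = begin
    Det Q′
      ≈⟨ det-column (fromℕ d) Q′ ⟩
    σ (fromℕ d) * ∑ (λ a → σ a * (Q′ a (fromℕ d) * Det (minor Q′ a (fromℕ d))))
      ≈⟨ *-cong refl (∑-last _) ⟩
    σ (fromℕ d) * (∑ (λ a → σ (inject₁ a) * (Q′ (inject₁ a) (fromℕ d) * Det (minor Q′ (inject₁ a) (fromℕ d))))
                  + σ (fromℕ d) * (Q′ (fromℕ d) (fromℕ d) * Det (minor Q′ (fromℕ d) (fromℕ d))))
      ≈⟨ *-cong refl (+-cong (∑-zero _ (λ a → trans (*-cong refl (trans (*-cong refl (Q-delete-minor s a)) (zeroʳ _))) (zeroʳ _)))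
                             (*-cong refl (*-cong (Q-delete-corner s) (det-cong old-rows)))) ⟩
    σ (fromℕ d) * (0# + σ (fromℕ d) * (- 1# * Det (Qof s)))
      ≈⟨ trans (*-cong refl (+-identityˡ _)) (sym (*-assoc _ _ _)) ⟩
    (σ (fromℕ d) * σ (fromℕ d)) * (- 1# * Det (Qof s))
      ≈⟨ trans (*-cong (sign-square (toℕ (fromℕ d))) refl) (trans (*-identityˡ _) (-1*x≈-x _)) ⟩
    - Det (Qof s) ∎
    where
    Q′ = Qof (delete s)
    old-rows : ∀ a b → minor Q′ (fromℕ d) (fromℕ d) a b ≈ Qof s a b
    old-rows a b = reflexive (≡.trans (cong₂ Q′ (punchIn-last a) (punchIn-last b))
                     (cong₂ (Pmat R n p) (snoc-inject₁ (deletedCols s) _ a) (toℕ-inject₁ b)))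

  -- The exponent grows by 1 + 2(n + d).
  sign-delete : ∀ {n d} (s : Split n d) → sign (exponent (delete s)) ≈ - sign (exponent s)
  sign-delete {n} {d} s = trans (reflexive (cong sign exponent≡)) (-‿cong (sign-even (n +ℕ d) (exponent s)))
    where
    sum≡ : sumℕ (λ b → suc (deletedCols (delete s) b)) ≡ sumℕ (λ b → suc (deletedCols s b)) +ℕ suc (n +ℕ d)
    sum≡ = ≡.trans (sumℕ-cong (snoc-map suc (deletedCols s) _)) (sumℕ-snoc (suc ∘ deletedCols s) _)
    exponent≡ : exponent (delete s) ≡ suc (n +ℕ d +ℕ (n +ℕ d) +ℕ exponent s)
    exponent≡ = ≡.trans (cong (λ S → n *ℕ suc d +ℕ S +ℕ triangle (suc d)) sum≡) (exponent-delete n d _)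

  claim-delete : ∀ {n d} (A : Matrix n) (s : Split n d) → Claim A s → Claim A (delete s)
  claim-delete A s claim = begin
    Det (keptColumns A s)                                           ≈⟨ claim ⟩
    sign (exponent s) * (Det (Qof s) * Det A)                       ≈⟨ sym (neg*neg-* _ _ _) ⟩
    (- sign (exponent s)) * ((- Det (Qof s)) * Det A)               ≈⟨ sym (*-cong (sign-delete s) (*-cong (Q-delete s) refl)) ⟩
    sign (exponent (delete s)) * (Det (Qof (delete s)) * Det A)     ∎

  -- Keeping the last column L = k + (d+1): that column is a combination of the earlier
  -- ones; by linearity and since repeated columns give determinant 0, only the deleted
  -- columns of s contribute.
  expand-kept-last : ∀ {k d} (A : Matrix (suc k)) (s : Split k (suc d)) →
    Det (keptColumns A (keep s))
      ≈ σ (fromℕ k) * ∑ (λ b → p (deletedCols s b) d * Det (withColumn (keptColumns A s) zero (column A (deletedCols s b))))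
  expand-kept-last {k} {d} A s = begin
    Det (keptColumns A (keep s))
      ≈⟨ det-cong (λ row a → reflexive (≡.trans (snoc-map (λ j → column A j row) (keptCols s) L a)
                                                 (≡.sym (insertAt-last (U row) _ a)))) ⟩
    Det (withColumn U (fromℕ k) (column A L))
      ≈⟨ det-withColumn U (fromℕ k) _ ⟩
    σ (fromℕ k) * Det (withColumn U zero (column A L))
      ≈⟨ *-cong refl (det-cong (withColumn-cong U last-combination)) ⟩
    σ (fromℕ k) * Det (withColumn U zero (λ row → ∑< L (λ i → p i d * column A i row)))
      ≈⟨ *-cong refl (det-linear U _ _) ⟩
    σ (fromℕ k) * ∑< L g
      ≈⟨ *-cong refl (∑<-split s g) ⟩
    σ (fromℕ k) * (∑ (g ∘ keptCols s) + ∑ (g ∘ deletedCols s))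
      ≈⟨ *-cong refl (trans (+-cong (∑-zero _ kept-vanish) refl) (+-identityˡ _)) ⟩
    σ (fromℕ k) * ∑ (g ∘ deletedCols s) ∎
    where
    L = k +ℕ suc d
    U = keptColumns A s
    g = λ i → p i d * Det (withColumn U zero (column A i))
    last-combination : ∀ row → column A L row ≈ ∑< L (λ i → p i d * column A i row)
    last-combination row = trans (column-new A L (≡.subst (suc k ≤_) (≡.sym (ℕ.+-suc k d)) (s≤s (ℕ.m≤m+n k d))) row)
      (∑-cong (λ i → *-cong (reflexive (cong (p (toℕ i)) (≡.trans (cong (_∸ suc k) (ℕ.+-suc k d)) (ℕ.m+n∸m≡n k d)))) refl))
    kept-vanish : ∀ a → g (keptCols s a) ≈ 0#
    kept-vanish a = trans (*-cong refl (det-repeated U _ a (λ row → refl))) (zeroʳ _)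

  -- The determinant with deleted column b of s in front is, up to the sign of moving it
  -- to its place t, the minor of the split restoring b.
  cofactor-restore : ∀ {k d} (A : Matrix (suc k)) (s : Split k (suc d)) b (t : Fin (suc k)) →
    keptCols (restore s b) ≗ insertAt (keptCols s) t (deletedCols s b) →
    Det (withColumn (keptColumns A s) zero (column A (deletedCols s b))) ≈ σ t * Det (keptColumns A (restore s b))
  cofactor-restore A s b t kept≗ = begin
    W₀                             ≈⟨ sym (trans (*-cong (sign-square (toℕ t)) refl) (*-identityˡ _)) ⟩
    (σ t * σ t) * W₀               ≈⟨ *-assoc _ _ _ ⟩
    σ t * (σ t * W₀)               ≈⟨ *-cong refl (sym (det-withColumn (keptColumns A s) t _)) ⟩
    σ t * Det (withColumn (keptColumns A s) t (column A (deletedCols s b)))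
                                   ≈⟨ *-cong refl (det-cong (λ row a → reflexive (≡.sym
                                        (≡.trans (cong (λ j → column A j row) (kept≗ a))
                                                 (insertAt-map (λ j → column A j row) (keptCols s) t _ a))))) ⟩
    σ t * Det (keptColumns A (restore s b)) ∎
    where
    W₀ = Det (withColumn (keptColumns A s) zero (column A (deletedCols s b)))

  -- Expanding Q along its last column d: the entries are p (J b) d, the minors are the
  -- matrices Q of the splits restoring b.
  Q-keep : ∀ {k d} (s : Split k (suc d)) →
    Det (Qof (keep s)) ≈ σ (fromℕ d) * ∑ (λ b → σ b * (p (deletedCols s b) d * Det (Qof (restore s b))))
  Q-keep {k} {d} s = trans (det-column (fromℕ d) (Qof (keep s))) (*-cong refl (∑-cong (λ b →
    *-cong refl (*-cong (reflexive entry) (det-cong (λ a c → reflexive (remaining-rows b a c)))))))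
    where
    entry : ∀ {b} → Qof (keep s) b (fromℕ d) ≡ p (deletedCols s b) d
    entry {b} = ≡.trans (cong (Pmat R (suc k) p (deletedCols s b)) (toℕ-fromℕ d))
      (Pmat-above (suc k) _ d (≡.subst (deletedCols s b <_) (ℕ.+-suc k d) (deletedCols< s b)))
    remaining-rows : ∀ b a c → minor (Qof (keep s)) b (fromℕ d) a c ≡ Qof (restore s b) a c
    remaining-rows b a c = cong₂ (Pmat R (suc k) p) (≡.sym (deletedCols-restore s b a))
      (≡.trans (cong toℕ (punchIn-last c)) (toℕ-inject₁ c))

  -- The signs match: moving the last column to the front (k), column J b to its place (t),
  -- and the exponent for the smaller split, against the exponent for s and the cofactor signs.
  sign-keep : ∀ {k d} (s : Split k (suc d)) b (t : Fin (suc k)) → toℕ t +ℕ toℕ b ≡ deletedCols s b →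
    σ (fromℕ k) * σ t * sign (exponent (restore s b)) ≈ sign (exponent (keep s)) * σ (fromℕ d) * σ b
  sign-keep {k} {d} s b t t+b≡ = begin
    σ (fromℕ k) * σ t * sign (exponent (restore s b))
      ≈⟨ sym (sign-+-+ (toℕ (fromℕ k)) (toℕ t) _) ⟩
    sign (toℕ (fromℕ k) +ℕ toℕ t +ℕ exponent (restore s b))
      ≈⟨ sym (sign-parity _ _ (suc (toℕ b +ℕ d)) parity) ⟩
    sign (exponent (keep s) +ℕ toℕ (fromℕ d) +ℕ toℕ b)
      ≈⟨ sign-+-+ (exponent (keep s)) _ _ ⟩
    sign (exponent (keep s)) * σ (fromℕ d) * σ b ∎
    where
    rest = sumℕ (λ c → suc (deletedCols s (punchIn b c)))
    sum≡ : sumℕ (λ b′ → suc (deletedCols s b′)) ≡ suc (toℕ t +ℕ toℕ b) +ℕ rest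
    sum≡ = ≡.trans (sumℕ-punchIn b (λ b′ → suc (deletedCols s b′))) (cong (λ x → suc x +ℕ rest) (≡.sym t+b≡))
    parity : exponent (keep s) +ℕ toℕ (fromℕ d) +ℕ toℕ b
             ≡ suc (toℕ b +ℕ d) +ℕ suc (toℕ b +ℕ d) +ℕ (toℕ (fromℕ k) +ℕ toℕ t +ℕ exponent (restore s b))
    parity = ≡.trans (cong₂ (λ S x → suc k *ℕ suc d +ℕ S +ℕ triangle (suc d) +ℕ x +ℕ toℕ b) sum≡ (toℕ-fromℕ d))
      (≡.trans (exponent-keep k d (toℕ t) (toℕ b) rest)
        (cong₂ (λ x S → suc (toℕ b +ℕ d) +ℕ suc (toℕ b +ℕ d) +ℕ (x +ℕ toℕ t +ℕ (suc k *ℕ d +ℕ S +ℕ triangle d)))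
          (≡.sym (toℕ-fromℕ k)) (sumℕ-cong (λ c → cong suc (≡.sym (deletedCols-restore s b c))))))

  claim-keep : ∀ {k d} (A : Matrix (suc k)) (s : Split k (suc d)) → (∀ b → Claim A (restore s b)) → Claim A (keep s)
  claim-keep {k} {d} A s claims = begin
    Det (keptColumns A (keep s))
      ≈⟨ expand-kept-last A s ⟩
    σ (fromℕ k) * ∑ (λ b → p (J b) d * W b)
      ≈⟨ trans (∑-*ˡ _ _) (∑-cong term) ⟩
    ∑ (λ b → sign e * ((σ (fromℕ d) * (σ b * (p (J b) d * Det (Qof (restore s b))))) * Det A))
      ≈⟨ sym (trans (*-cong refl (trans (*-cong (trans (Q-keep s) (∑-*ˡ _ _)) refl) (∑-*ʳ _ _))) (∑-*ˡ _ _)) ⟩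
    sign e * (Det (Qof (keep s)) * Det A) ∎
    where
    J = deletedCols s
    e = exponent (keep s)
    W = λ b → Det (withColumn (keptColumns A s) zero (column A (J b)))
    term : ∀ b → σ (fromℕ k) * (p (J b) d * W b) ≈ sign e * ((σ (fromℕ d) * (σ b * (p (J b) d * Det (Qof (restore s b))))) * Det A)
    term b with keptCols-restore s b
    ... | t , t+b≡ , kept≗ = begin
      σ (fromℕ k) * (p (J b) d * W b)
        ≈⟨ *-cong refl (*-cong refl (trans (cofactor-restore A s b t kept≗) (*-cong refl (claims b)))) ⟩
      σ (fromℕ k) * (p (J b) d * (σ t * (sign (exponent (restore s b)) * (Det (Qof (restore s b)) * Det A))))
        ≈⟨ solve 6 (λ x y z P Q D → x :* (P :* (y :* (z :* (Q :* D)))) := (x :* y :* z) :* (P :* Q :* D)) refl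
             (σ (fromℕ k)) (σ t) (sign (exponent (restore s b))) (p (J b) d) (Det (Qof (restore s b))) (Det A) ⟩
      (σ (fromℕ k) * σ t * sign (exponent (restore s b))) * (p (J b) d * Det (Qof (restore s b)) * Det A)
        ≈⟨ *-cong (sign-keep s b t t+b≡) refl ⟩
      (sign e * σ (fromℕ d) * σ b) * (p (J b) d * Det (Qof (restore s b)) * Det A)
        ≈⟨ solve 6 (λ x y z P Q D → (x :* y :* z) :* (P :* Q :* D) := x :* ((y :* (z :* (P :* Q))) :* D)) refl
             (sign e) (σ (fromℕ d)) (σ b) (p (J b) d) (Det (Qof (restore s b))) (Det A) ⟩
      sign e * ((σ (fromℕ d) * (σ b * (p (J b) d * Det (Qof (restore s b))))) * Det A) ∎

  claim : ∀ {n d} (A : Matrix n) (s : Split n d) → Claim A s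
  claim {d = zero}  A s          = claim-all-kept A s
  claim {d = suc d} A (keep s)   = claim-keep A s (λ b → claim A (restore s b))
  claim {d = suc d} A (delete s) = claim-delete A s (claim A s)

theorem1 : ∀ {c ℓ : Level} (R : CommutativeRing c ℓ) →
    let open CommutativeRing R in
    (n r : ℕ) → 1 ≤ n → 1 ≤ r →
    (A : Fin n → Fin n → Carrier) →
    (p : ℕ → ℕ → Carrier) →
    (J : Fin r → Fin (n +ℕ r)) →
    (∀ a b → toℕ a < toℕ b → toℕ (J a) < toℕ (J b)) →
    (∀ b → suc (toℕ (J b)) < n +ℕ r) →
    (K : Fin n → Fin (n +ℕ r)) →
    (∀ a b → toℕ a < toℕ b → toℕ (K a) < toℕ (K b)) →
    (∀ a b → K a ≢ J b) →
    (∀ k → (∃ λ a → K a ≡ k) ⊎ (∃ λ b → J b ≡ k)) →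
    det R (λ row a → Extended.Ar R n A p r row (K a))
    ≈ signPow R (n *ℕ r +ℕ sumℕ (λ b → suc (toℕ (J b))) +ℕ ⌊ (r ∸ 1) *ℕ r /2⌋)
    * (det R (λ a b → Pmat R n p (toℕ (J a)) (toℕ b)) * det R A)
theorem1 R n r _ _ A p J J-increasing _ K K-increasing disjoint covering =
  let s , _ , kept≗ , deleted≗ = splitOf (n +ℕ r) (complementary K J K-increasing J-increasing disjoint covering) in
  begin
    det R (λ row a → Extended.Ar R n A p r row (K a))
      ≈⟨ det≈Det _ ⟩
    Det (λ row a → Extended.Ar R n A p r row (K a))
      ≈⟨ det-cong (λ row a → reflexive (≡.trans (prefix-column A _ (K a) row) (cong (λ j → column A j row) (≡.sym (kept≗ a))))) ⟩
    Det (keptColumns A s)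
      ≈⟨ claim A s ⟩
    sign (exponent s) * (Det (Qof s) * Det A)
      ≈⟨ *-cong (reflexive (cong sign (cong₂ (λ S x → n *ℕ r +ℕ S +ℕ x) (sumℕ-cong (cong suc ∘ deleted≗)) (≡.sym (triangle-half r)))))
                (*-cong (trans (det-cong (λ a b → reflexive (cong (λ i → Pmat R n p i (toℕ b)) (deleted≗ a)))) (sym (det≈Det _)))
                        (sym (det≈Det A))) ⟩
    signPow R (n *ℕ r +ℕ sumℕ (λ b → suc (toℕ (J b))) +ℕ ⌊ (r ∸ 1) *ℕ r /2⌋)
    * (det R (λ a b → Pmat R n p (toℕ (J a)) (toℕ b)) * det R A) ∎
  where
  open CommutativeRing R
  open Determinants R
  open Extension R p
  open ≈-Reasoning setoid
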